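{- For all integers $m,n>1$, $\tau(T_{m\times n})\leq 2\gcd(m,n)$.
   Context: For integers $m,n>1$, the discrete torus is $T_{m\times n}=\{0,\dots,m-1\}\times\{0,\dots,n-1\}$, with projection $\pi_{m,n}:\mathbb Z\times\mathbb Z\to T_{m\times n}$, $\pi_{m,n}(a,b)=(a \bmod m,\ b\bmod n)$ (least non-negative remainders). A line in $\mathbb Z\times\mathbb Z$ is a set $\{(a+uk,b+vk):k\in\mathbb Z\}$ with $a,b,u,v\in\mathbb Z$ and $\gcd(u,v)=1$. A line on $T_{m\times n}$ is the image under $\pi_{m,n}$ of a line in $\mathbb Z\times\mathbb Z$. Three points of $T_{m\times n}$ are collinear if some line on $T_{m\times n}$ contains all three. A set $X\subset T_{m\times n}$ satisfies the no-three-in-line condition if no three distinct points of $X$ are collinear, and $\tau(T_{m\times n})$ denotes the maximum size of such a set. -}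

module Defs where

open import Data.Nat using (ℕ; NonZero)
open import Data.Nat.GCD using (gcd)
open import Data.Integer using (ℤ; _+_; _*_; ∣_∣)
open import Data.Integer.DivMod using (_%ℕ_)
open import Data.Fin using (Fin; toℕ)
open import Data.Product using (_×_; _,_; ∃; ∃-syntax)
open import Data.List using (List)
open import Data.List.Membership.Propositional using (_∈_)
open import Relation.Binary.PropositionalEquality using (_≡_; _≢_)
open import Relation.Nullary using (¬_)

Point : ℕ → ℕ → Set
Point m n = Fin m × Fin n

πHits : (m n : ℕ) .{{_ : NonZero m}} .{{_ : NonZero n}} → ℤ → ℤ → Point m n → Set
πHits m n x y (i , j) = (x %ℕ m ≡ toℕ i) × (y %ℕ n ≡ toℕ j)

-- A line in ℤ×ℤ given by (a,b,u,v) with gcd(u,v)=1; the point p lies on its image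
-- under π_{m,n} iff p = π_{m,n}(a+uk, b+vk) for some k ∈ ℤ.
OnTorusLine : (m n : ℕ) .{{_ : NonZero m}} .{{_ : NonZero n}} →
              (a b u v : ℤ) → Point m n → Set
OnTorusLine m n a b u v p = ∃[ k ] πHits m n (a + u * k) (b + v * k) p

Collinear : (m n : ℕ) .{{_ : NonZero m}} .{{_ : NonZero n}} →
            Point m n → Point m n → Point m n → Set
Collinear m n p q r =
  ∃[ a ] ∃[ b ] ∃[ u ] ∃[ v ]
    (gcd ∣ u ∣ ∣ v ∣ ≡ 1) ×
    OnTorusLine m n a b u v p × OnTorusLine m n a b u v q × OnTorusLine m n a b u v r

NoThreeInLine : (m n : ℕ) .{{_ : NonZero m}} .{{_ : NonZero n}} → List (Point m n) → Set
NoThreeInLine m n X =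
  ∀ p q r → p ∈ X → q ∈ X → r ∈ X → p ≢ q → p ≢ r → q ≢ r → ¬ Collinear m n p q r

-- Points (i, j) with the same value of i − j modulo g = gcd m n lie on one line of
-- slope 1: by the Chinese remainder theorem for the moduli m and n, whose only
-- compatibility condition is a congruence modulo g, the points (c + k, k) reach every
-- (i, j) with c ≡ i − j (mod g). A no-three-in-line set meets each of these g lines in
-- at most two points.
module Submission where

open import Defs
open import Data.Nat using (ℕ; NonZero; _<_; _≤_; _*_; zero; suc; _+_; _∸_; z≤n; s≤s; _≟_; ≢-nonZero)
open import Data.Nat.GCD using (gcd; gcd[m,n]≢0; gcd[m,n]∣n; gcd-comm; gcd-zeroˡ; gcd-GCD; module Bézout)
open import Data.List using (List; length; []; _∷_; filter)
open import Data.List.Relation.Unary.Unique.Propositional using (Unique)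

open import Data.Nat.Properties
open import Data.Nat.Divisibility using (_∣_; divides)
open import Data.Nat.DivMod
open import Data.Nat.Tactic.RingSolver using (solve-∀)
open import Data.Integer as ℤ using (+_)
import Data.Integer.Properties as ℤ
open import Data.Fin using (toℕ)
open import Data.Fin.Properties using (toℕ<n; toℕ≤n)
open import Data.Bool using (true; false)
open import Data.Product using (_,_; ∃-syntax)
open import Data.Sum using (inj₁)
open import Data.Empty using (⊥; ⊥-elim)
open import Data.List.Relation.Unary.All as All using (All; []; _∷_)
open import Data.List.Relation.Unary.All.Properties using (all-filter; filter⁺)
open import Data.List.Relation.Unary.AllPairs using ([]; _∷_)
open import Data.List.Relation.Unary.Any using (here; there)
open import Data.List.Membership.Propositional using (_∈_)
open import Data.List.Membership.Propositional.Properties using (∈-filter⁻)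
import Data.List.Relation.Unary.Unique.Propositional.Properties as Unique
import Data.List.Relation.Binary.Sublist.Propositional.Properties as Sublist
open import Relation.Nullary using (does; ¬?)
open import Relation.Unary using (Decidable)
open import Relation.Binary.PropositionalEquality

module _ {A : Set} where

  unique-without-three⇒length≤2 : {xs : List A} → Unique xs →
    (∀ x y z → x ∈ xs → y ∈ xs → z ∈ xs → x ≢ y → x ≢ z → y ≢ z → ⊥) →
    length xs ≤ 2
  unique-without-three⇒length≤2 {[]} _ _ = z≤n
  unique-without-three⇒length≤2 {_ ∷ []} _ _ = s≤s z≤n
  unique-without-three⇒length≤2 {_ ∷ _ ∷ []} _ _ = s≤s (s≤s z≤n)
  unique-without-three⇒length≤2 {x ∷ y ∷ z ∷ _} ((x≢y ∷ x≢z ∷ _) ∷ (y≢z ∷ _) ∷ _) noThree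
    = ⊥-elim (noThree x y z (here refl) (there (here refl)) (there (there (here refl))) x≢y x≢z y≢z)

  length≡length-filter+length-filter-¬ : ∀ {P : A → Set} (P? : Decidable P) xs →
    length xs ≡ length (filter P? xs) + length (filter (λ x → ¬? (P? x)) xs)
  length≡length-filter+length-filter-¬ P? [] = refl
  length≡length-filter+length-filter-¬ P? (x ∷ xs) with does (P? x)
  ... | true  = cong suc (length≡length-filter+length-filter-¬ P? xs)
  ... | false = trans (cong suc (length≡length-filter+length-filter-¬ P? xs)) (sym (+-suc _ _))

module _ {A : Set} (f : A → ℕ) where

  fibre : ℕ → List A → List A
  fibre h = filter (λ x → f x ≟ h)

  pigeonhole-fibres : ∀ k g (xs : List A) → All (λ x → f x < g) xs →
    (∀ h → length (fibre h xs) ≤ k) → length xs ≤ k * g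
  pigeonhole-fibres k zero [] _ _ = z≤n
  pigeonhole-fibres k zero (x ∷ xs) (() ∷ _) _
  pigeonhole-fibres k (suc g) xs f<1+g fibres≤k = begin
      length xs                                 ≡⟨ length≡length-filter+length-filter-¬ (λ x → f x ≟ g) xs ⟩
      length (fibre g xs) + length rest         ≤⟨ +-mono-≤ (fibres≤k g) rest≤k*g ⟩
      k + k * g                                 ≡⟨ *-suc k g ⟨
      k * suc g                                 ∎
    where
      open ≤-Reasoning
      rest : List A
      rest = filter (λ x → ¬? (f x ≟ g)) xs

      rest<g : All (λ x → f x < g) rest
      rest<g = All.zipWith (λ (fx<1+g , fx≢g) → ≤∧≢⇒< (m<1+n⇒m≤n fx<1+g) fx≢g)
                 (filter⁺ _ f<1+g , all-filter _ xs)

      rest≤k*g : length rest ≤ k * g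
      rest≤k*g = pigeonhole-fibres k g rest rest<g λ h →
        ≤-trans (Sublist.length-mono-≤ (Sublist.filter⁺ _ _ (λ { refl p → p }) (Sublist.filter-⊆ _ xs)))
                (fibres≤k h)

instance
  gcd-nonZero : ∀ {m n} .{{_ : NonZero m}} → NonZero (gcd m n)
  gcd-nonZero {m@(suc _)} {n} = ≢-nonZero (gcd[m,n]≢0 m n (inj₁ λ ()))

-- Bézout gives g + y n ≡ x m or g + x m ≡ y n; in the second case the multiple
-- (t y + t x) m n is added to both sides to move t x m across.
m∣gcd-multiple+n-multiple : ∀ m n .{{_ : NonZero m}} .{{_ : NonZero n}} t →
  ∃[ s ] m ∣ t * gcd m n + s * n
m∣gcd-multiple+n-multiple m@(suc m′) n@(suc n′) t with Bézout.identity (gcd-GCD m n)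
... | Bézout.+- x y g+yn≡xm = t * y , divides (t * x) (begin
      t * gcd m n + t * y * n   ≡⟨ cong (λ w → t * gcd m n + w) (*-assoc t y n) ⟩
      t * gcd m n + t * (y * n) ≡⟨ *-distribˡ-+ t (gcd m n) (y * n) ⟨
      t * (gcd m n + y * n)     ≡⟨ cong (t *_) g+yn≡xm ⟩
      t * (x * m)               ≡⟨ *-assoc t x m ⟨
      t * x * m                 ∎)
  where open ≡-Reasoning
... | Bézout.-+ x y g+xm≡yn = t * y * m′ + t * x * m , divides (t * y * n + t * x * n′) (begin
      t * gcd m n + (t * y * m′ + t * x * m) * n  ≡⟨ regroup t (gcd m n) x y m′ n′ ⟩
      t * (gcd m n + x * m) + t * y * m′ * n + t * x * m * n′
        ≡⟨ cong (λ w → t * w + t * y * m′ * n + t * x * m * n′) g+xm≡yn ⟩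
      t * (y * n) + t * y * m′ * n + t * x * m * n′  ≡⟨ collect t x y m′ n′ ⟩
      (t * y * n + t * x * n′) * m                   ∎)
  where
    open ≡-Reasoning
    regroup : ∀ t g x y m′ n′ → t * g + (t * y * m′ + t * x * suc m′) * suc n′ ≡
              t * (g + x * suc m′) + t * y * m′ * suc n′ + t * x * suc m′ * n′
    regroup = solve-∀
    collect : ∀ t x y m′ n′ → t * (y * suc n′) + t * y * m′ * suc n′ + t * x * suc m′ * n′ ≡
              (t * y * suc n′ + t * x * n′) * suc m′
    collect = solve-∀

-- Write a = r + p g and b = r + q g; then m ∣ p g + s₁ n and q g + s₂ m = z₂ n give
-- a + (s₁ + z₂) n = b + (p g + s₁ n) + s₂ m.
congruent-mod-gcd⇒shift : ∀ m n .{{_ : NonZero m}} .{{_ : NonZero n}} {a b} →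
  a % gcd m n ≡ b % gcd m n → ∃[ s ] (a + s * n) % m ≡ b % m
congruent-mod-gcd⇒shift m n {a} {b} a≡b[g]
  with m∣gcd-multiple+n-multiple m n (a / gcd m n) | m∣gcd-multiple+n-multiple n m (b / gcd m n)
... | s₁ , m∣pg+s₁n | s₂ , divides z₂ qg′+s₂m≡z₂n = s₁ + z₂ , (begin
      (a + (s₁ + z₂) * n) % m            ≡⟨ cong (_% m) shift ⟩
      (b + (p * g + s₁ * n) + s₂ * m) % m ≡⟨ [m+kn]%n≡m%n _ s₂ m ⟩
      (b + (p * g + s₁ * n)) % m         ≡⟨ %-remove-+ʳ b m∣pg+s₁n ⟩
      b % m                              ∎)
  where
    open ≡-Reasoning
    g p q : ℕ
    g = gcd m n
    p = a / g
    q = b / g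

    qg+s₂m≡z₂n : q * g + s₂ * m ≡ z₂ * n
    qg+s₂m≡z₂n = subst (λ h → q * h + s₂ * m ≡ z₂ * n) (gcd-comm n m) qg′+s₂m≡z₂n

    regroupˡ : ∀ r x s z n → r + x + (s + z) * n ≡ r + (x + s * n) + z * n
    regroupˡ = solve-∀
    regroupʳ : ∀ r x y w → r + x + (y + w) ≡ r + y + x + w
    regroupʳ = solve-∀

    shift : a + (s₁ + z₂) * n ≡ b + (p * g + s₁ * n) + s₂ * m
    shift = begin
      a + (s₁ + z₂) * n                            ≡⟨ cong (λ w → w + (s₁ + z₂) * n) (m≡m%n+[m/n]*n a g) ⟩
      a % g + p * g + (s₁ + z₂) * n                ≡⟨ regroupˡ (a % g) (p * g) s₁ z₂ n ⟩
      a % g + (p * g + s₁ * n) + z₂ * n            ≡⟨ cong₂ (λ r w → r + (p * g + s₁ * n) + w) (sym a≡b[g]) qg+s₂m≡z₂n ⟨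
      b % g + (p * g + s₁ * n) + (q * g + s₂ * m)  ≡⟨ regroupʳ (b % g) (p * g + s₁ * n) (q * g) (s₂ * m) ⟩
      b % g + q * g + (p * g + s₁ * n) + s₂ * m    ≡⟨ cong (λ w → w + (p * g + s₁ * n) + s₂ * m) (m≡m%n+[m/n]*n b g) ⟨
      b + (p * g + s₁ * n) + s₂ * m                ∎

module _ (m n : ℕ) .{{_ : NonZero m}} .{{_ : NonZero n}} where

  -- i − j modulo gcd m n; adding n keeps the subtraction in ℕ.
  diagonal : Point m n → ℕ
  diagonal (i , j) = (toℕ i + (n ∸ toℕ j)) % gcd m n

  diagonal<gcd : ∀ p → diagonal p < gcd m n
  diagonal<gcd (i , j) = m%n<n _ (gcd m n)

  diagonal+j≡i-mod-gcd : ∀ i j → (diagonal (i , j) + toℕ j) % gcd m n ≡ toℕ i % gcd m n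
  diagonal+j≡i-mod-gcd i j = begin
      ((toℕ i + (n ∸ toℕ j)) % g + toℕ j) % g       ≡⟨ %-distribˡ-+ _ (toℕ j) g ⟩
      ((toℕ i + (n ∸ toℕ j)) % g % g + toℕ j % g) % g ≡⟨ cong (λ w → (w + toℕ j % g) % g) (m%n%n≡m%n _ g) ⟩
      ((toℕ i + (n ∸ toℕ j)) % g + toℕ j % g) % g    ≡⟨ %-distribˡ-+ _ (toℕ j) g ⟨
      (toℕ i + (n ∸ toℕ j) + toℕ j) % g              ≡⟨ cong (_% g) (+-assoc (toℕ i) (n ∸ toℕ j) (toℕ j)) ⟩
      (toℕ i + (n ∸ toℕ j + toℕ j)) % g              ≡⟨ cong (λ w → (toℕ i + w) % g) (m∸n+n≡m (toℕ≤n j)) ⟩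
      (toℕ i + n) % g                                ≡⟨ %-remove-+ʳ (toℕ i) (gcd[m,n]∣n m n) ⟩
      toℕ i % g                                      ∎
    where open ≡-Reasoning; g = gcd m n

  onDiagonal : ∀ p → OnTorusLine m n (+ diagonal p) (+ 0) (+ 1) (+ 1) p
  onDiagonal (i , j) with congruent-mod-gcd⇒shift m n (diagonal+j≡i-mod-gcd i j)
  ... | s , shifted = + k , first , second
    where
      open ≡-Reasoning
      c k : ℕ
      c = diagonal (i , j)
      k = toℕ j + s * n

      first : (+ c ℤ.+ + 1 ℤ.* + k) ℤ.%ℕ m ≡ toℕ i
      first = begin
        (+ c ℤ.+ + 1 ℤ.* + k) ℤ.%ℕ m ≡⟨ cong (λ w → (+ c ℤ.+ w) ℤ.%ℕ m) (ℤ.*-identityˡ (+ k)) ⟩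
        (+ c ℤ.+ + k) ℤ.%ℕ m          ≡⟨ cong (ℤ._%ℕ m) (ℤ.pos-+ c k) ⟨
        (c + k) % m                    ≡⟨ cong (_% m) (+-assoc c (toℕ j) (s * n)) ⟨
        (c + toℕ j + s * n) % m        ≡⟨ shifted ⟩
        toℕ i % m                      ≡⟨ m<n⇒m%n≡m (toℕ<n i) ⟩
        toℕ i                          ∎

      second : (+ 0 ℤ.+ + 1 ℤ.* + k) ℤ.%ℕ n ≡ toℕ j
      second = begin
        (+ 0 ℤ.+ + 1 ℤ.* + k) ℤ.%ℕ n ≡⟨ cong (ℤ._%ℕ n) (trans (ℤ.+-identityˡ _) (ℤ.*-identityˡ (+ k))) ⟩
        k % n                          ≡⟨ [m+kn]%n≡m%n (toℕ j) s n ⟩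
        toℕ j % n                      ≡⟨ m<n⇒m%n≡m (toℕ<n j) ⟩
        toℕ j                          ∎

  sameDiagonal⇒collinear : ∀ p q r → diagonal p ≡ diagonal q → diagonal p ≡ diagonal r →
    Collinear m n p q r
  sameDiagonal⇒collinear p q r p~q p~r =
    + diagonal p , + 0 , + 1 , + 1 , gcd-zeroˡ 1 ,
    onDiagonal p , onDiagonalOf q p~q , onDiagonalOf r p~r
    where
      onDiagonalOf : ∀ x → diagonal p ≡ diagonal x → OnTorusLine m n (+ diagonal p) (+ 0) (+ 1) (+ 1) x
      onDiagonalOf x p~x = subst (λ c → OnTorusLine m n (+ c) (+ 0) (+ 1) (+ 1) x) (sym p~x) (onDiagonal x)

  diagonalFibre≤2 : ∀ {X} → Unique X → NoThreeInLine m n X → ∀ h → length (fibre diagonal h X) ≤ 2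
  diagonalFibre≤2 {X} unique noThree h =
    unique-without-three⇒length≤2 (Unique.filter⁺ _ unique) λ x y z x∈ y∈ z∈ x≢y x≢z y≢z →
      let x∈X , x↦h = ∈-filter⁻ _ x∈
          y∈X , y↦h = ∈-filter⁻ _ y∈
          z∈X , z↦h = ∈-filter⁻ _ z∈
      in noThree x y z x∈X y∈X z∈X x≢y x≢z y≢z
           (sameDiagonal⇒collinear x y z (trans x↦h (sym y↦h)) (trans x↦h (sym z↦h)))

theorem1p1 : (m n : ℕ) .{{_ : NonZero m}} .{{_ : NonZero n}} → 1 < m → 1 < n →
    (X : List (Point m n)) → Unique X → NoThreeInLine m n X →
    length X ≤ 2 * gcd m n
theorem1p1 m n _ _ X unique noThree =
  pigeonhole-fibres (diagonal m n) 2 (gcd m n) X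
    (All.tabulate λ {p} _ → diagonal<gcd m n p)
    (diagonalFibre≤2 m n unique noThree)
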